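{- For each integer $k\geq 3$ and each integer $r$ with $1\leq r\leq k-1$, there exists a graph $Q_{k,r}$ such that $\Gamma(Q_{k,r})=k$, $\gamma(Q_{k,r})=r$ and $d_0(Q_{k,r})=k+r=\Gamma(Q_{k,r})+\gamma(Q_{k,r})$.
   Context: All graphs are finite and simple. For a graph $G$, $\gamma(G)$ is the domination number (minimum cardinality of a dominating set) and $\Gamma(G)$ is the upper domination number (maximum cardinality of a minimal dominating set). For an integer $k$, the $k$-dominating graph $D_k(G)$ has as vertices the dominating sets of $G$ of cardinality at most $k$, two such sets being adjacent if and only if one can be obtained from the other by adding or deleting a single vertex of $G$. $d_0(G)$ denotes the smallest integer such that $D_k(G)$ is connected for all $k\geq d_0(G)$. -}

module Defs where

open import Data.Nat using (ℕ; _≤_; _<_; _+_)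
open import Data.Bool using (Bool; true; false)
open import Data.Fin using (Fin)
open import Data.Fin.Subset using (Subset; _∈_; _∉_; _⊂_; _∪_; ⁅_⁆; ∣_∣)
open import Data.Product using (Σ; ∃; _×_)
open import Data.Sum using (_⊎_)
open import Relation.Binary.PropositionalEquality using (_≡_)
open import Relation.Nullary using (¬_)

record Graph : Set where
  field
    n      : ℕ
    adj    : Fin n → Fin n → Bool
    sym    : ∀ u v → adj u v ≡ adj v u
    irrefl : ∀ v → adj v v ≡ false
open Graph public

module _ (G : Graph) where

  Dominating : Subset (n G) → Set
  Dominating S = ∀ v → v ∈ S ⊎ ∃ (λ u → u ∈ S × adj G u v ≡ true)

  MinimalDominating : Subset (n G) → Set
  MinimalDominating S = Dominating S × (∀ T → T ⊂ S → ¬ Dominating T)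

  IsDominationNumber : ℕ → Set
  IsDominationNumber r =
    (Σ (Subset (n G)) λ S → Dominating S × ∣ S ∣ ≡ r) ×
    (∀ S → Dominating S → r ≤ ∣ S ∣)

  IsUpperDominationNumber : ℕ → Set
  IsUpperDominationNumber k =
    (Σ (Subset (n G)) λ S → MinimalDominating S × ∣ S ∣ ≡ k) ×
    (∀ S → MinimalDominating S → ∣ S ∣ ≤ k)

  DkVertex : ℕ → Subset (n G) → Set
  DkVertex k S = Dominating S × ∣ S ∣ ≤ k

  AddOne : Subset (n G) → Subset (n G) → Set
  AddOne S T = ∃ λ v → v ∉ S × T ≡ S ∪ ⁅ v ⁆

  DkAdj : Subset (n G) → Subset (n G) → Set
  DkAdj S T = AddOne S T ⊎ AddOne T S

  data DkPath (k : ℕ) : Subset (n G) → Subset (n G) → Set where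
    here : ∀ {S} → DkVertex k S → DkPath k S S
    step : ∀ {S T U} → DkVertex k S → DkAdj S T → DkPath k T U → DkPath k S U

  DkConnected : ℕ → Set
  DkConnected k = ∀ S T → DkVertex k S → DkVertex k T → DkPath k S T

  IsD0 : ℕ → Set
  IsD0 m =
    (∀ j → m ≤ j → DkConnected j) ×
    (∀ m' → (∀ j → m' ≤ j → DkConnected j) → m ≤ m')

-- The graph Q has a k-clique S = {s i}, a vertex w and vertices d j adjacent to all of S and
-- to w, and for each column j a clique {x i j} ∪ {d j} in which x i j is also joined to s i.
-- A dominating set either contains S or misses some s b, and then must meet every column to
-- dominate the x b j; so γ = r, attained by D = {d j}. A minimal dominating set containing S
-- is S itself, and one missing s b has at most one vertex in S ∪ {w} and one in each column
-- (a second one would have no private neighbour), so Γ = k. In every graph D_j is connected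
-- once j ≥ Γ + γ: walk from X down to a minimal dominating M ⊆ X, up to M ∪ D, down to D.
-- For j = k + r − 1 a walk starting at S never deletes a vertex s i, because the set before
-- the deletion would contain S together with a dominating set avoiding s i, i.e. k + r
-- vertices; hence S and D lie in different components and d₀ = k + r.
module Submission where

open import Defs hiding (sym)
open import Data.Nat using (ℕ; _≤_; _<_; _+_; _*_; z≤n; s≤s; suc)
open import Data.Nat.Properties
  using (≤-reflexive; ≤-trans; ≤-antisym; ≰⇒>; <⇒≤; <⇒≱; _≤?_; +-suc; +-monoʳ-≤; +-mono-≤; m≤m+n)
open import Data.Bool using (true)
import Data.Bool as Bool
open import Data.Fin using (Fin; zero; suc; _≟_; splitAt; join)
open import Data.Fin.Properties
  using (any?; all?; ¬∀⟶∃¬; suc-injective; 0≢1+n; join-splitAt; +↔⊎; *↔×)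
open import Data.Fin.Subset
  using (Subset; _∈_; _∉_; _⊆_; _⊂_; _∪_; _─_; _-_; ⁅_⁆; ∣_∣; ⊤; inside; outside)
open import Data.Fin.Subset.Properties
  using ( _∈?_; ∈⊤; x∈⁅x⁆; x∈⁅y⁆⇒x≡y; x∈p∪q⁺; x∈p∪q⁻; p⊆p∪q; q⊆p∪q; p─q⊆p; x∈p∧x≢y⇒x∈p-y
        ; x∈p⇒p-x⊂p; ⊆-refl; ⊆-antisym; p⊆q⇒∣p∣≤∣q∣; ∣p∣≤∣x∷p∣; ∣p─q∣≤∣p∣; x∈p⇒∣p-x∣<∣p∣; ∣⊤∣≡n)
open import Data.Fin.Subset.Induction using (⊂-wellFounded; Acc; acc)
open import Data.Vec using ([]; _∷_; tabulate; here; there)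
open import Data.Vec.Properties using (lookup∘tabulate; lookup⇒[]=; []=⇒lookup)
open import Data.Product using (Σ; ∃; _×_; _,_; proj₁; proj₂)
open import Data.Sum using (_⊎_; inj₁; inj₂; [_,_]; swap)
open import Data.Sum.Function.Propositional using (_⊎-↔_)
open import Data.Empty using (⊥; ⊥-elim)
open import Function using (_∘_)
open import Function.Bundles using (Inverse; _↔_; mk⇔; mk↔ₛ′)
open import Function.Definitions using (Injective)
open import Function.Properties.Inverse using (↔-refl; ↔-sym; ↔-trans)
open import Relation.Binary.Definitions using (DecidableEquality)
open import Relation.Binary.PropositionalEquality using (_≡_; _≢_; refl; sym; trans; cong; subst)
open import Relation.Nullary using (¬_; Dec; yes; no; does; contradiction)
open import Relation.Nullary.Decidable
  using (_×-dec_; _⊎-dec_; ¬?; dec-true; dec-false; does-⇔; map′)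

∣p∪q∣≤∣p∣+∣q∣ : ∀ {n} (p q : Subset n) → ∣ p ∪ q ∣ ≤ ∣ p ∣ + ∣ q ∣
∣p∪q∣≤∣p∣+∣q∣ [] [] = z≤n
∣p∪q∣≤∣p∣+∣q∣ (inside ∷ p) (b ∷ q) =
  s≤s (≤-trans (∣p∪q∣≤∣p∣+∣q∣ p q) (+-monoʳ-≤ ∣ p ∣ (∣p∣≤∣x∷p∣ b q)))
∣p∪q∣≤∣p∣+∣q∣ (outside ∷ p) (inside ∷ q) =
  subst (suc ∣ p ∪ q ∣ ≤_) (sym (+-suc ∣ p ∣ ∣ q ∣)) (s≤s (∣p∪q∣≤∣p∣+∣q∣ p q))
∣p∪q∣≤∣p∣+∣q∣ (outside ∷ p) (outside ∷ q) = ∣p∪q∣≤∣p∣+∣q∣ p q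

x∈p─q⇒x∉q : ∀ {n} {x : Fin n} (p q : Subset n) → x ∈ p ─ q → x ∉ q
x∈p─q⇒x∉q (_ ∷ p) (outside ∷ q) here ()
x∈p─q⇒x∉q (_ ∷ p) (inside ∷ q) () here
x∈p─q⇒x∉q (_ ∷ p) (_ ∷ q) (there x∈) (there x∈q) = x∈p─q⇒x∉q p q x∈ x∈q

x∉p-x : ∀ {n} (p : Subset n) (x : Fin n) → x ∉ p - x
x∉p-x p x x∈ = x∈p─q⇒x∉q p ⁅ x ⁆ x∈ (x∈⁅x⁆ x)

x∈p⇒p≡p-x∪⁅x⁆ : ∀ {n} {p : Subset n} {x : Fin n} → x ∈ p → p ≡ (p - x) ∪ ⁅ x ⁆
x∈p⇒p≡p-x∪⁅x⁆ {p = p} {x} x∈p = ⊆-antisym ⊆-∪ ∪-⊆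
  where
  ⊆-∪ : p ⊆ (p - x) ∪ ⁅ x ⁆
  ⊆-∪ {a} a∈p with a ≟ x
  ... | yes refl = x∈p∪q⁺ (inj₂ (x∈⁅x⁆ x))
  ... | no a≢x = x∈p∪q⁺ (inj₁ (x∈p∧x≢y⇒x∈p-y a∈p a≢x))
  ∪-⊆ : (p - x) ∪ ⁅ x ⁆ ⊆ p
  ∪-⊆ {a} a∈ with x∈p∪q⁻ (p - x) ⁅ x ⁆ a∈
  ... | inj₁ a∈p-x = p─q⊆p p ⁅ x ⁆ a∈p-x
  ... | inj₂ a∈⁅x⁆ = subst (_∈ p) (sym (x∈⁅y⁆⇒x≡y x a∈⁅x⁆)) x∈p

injectiveOn⇒∣p∣≤∣q∣ : ∀ {n m} (p : Subset n) (q : Subset m) (f : Fin n → Fin m) →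
  (∀ {a} → a ∈ p → f a ∈ q) → (∀ {a b} → a ∈ p → b ∈ p → f a ≡ f b → a ≡ b) →
  ∣ p ∣ ≤ ∣ q ∣
injectiveOn⇒∣p∣≤∣q∣ [] q f f∈q inj = z≤n
injectiveOn⇒∣p∣≤∣q∣ (outside ∷ p) q f f∈q inj =
  injectiveOn⇒∣p∣≤∣q∣ p q (f ∘ suc) (f∈q ∘ there)
    (λ a∈ b∈ → suc-injective ∘ inj (there a∈) (there b∈))
injectiveOn⇒∣p∣≤∣q∣ (inside ∷ p) q f f∈q inj =
  ≤-trans (s≤s ∣p∣≤∣q-f0∣) (x∈p⇒∣p-x∣<∣p∣ (f∈q here))
  where
  f∈q-f0 : ∀ {a} → a ∈ p → f (suc a) ∈ q - f zero
  f∈q-f0 a∈ = x∈p∧x≢y⇒x∈p-y (f∈q (there a∈)) (λ e → 0≢1+n (sym (inj (there a∈) here e)))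
  ∣p∣≤∣q-f0∣ : ∣ p ∣ ≤ ∣ q - f zero ∣
  ∣p∣≤∣q-f0∣ = injectiveOn⇒∣p∣≤∣q∣ p (q - f zero) (f ∘ suc) f∈q-f0
    (λ a∈ b∈ → suc-injective ∘ inj (there a∈) (there b∈))

injectiveOn⇒∣p∣≤m : ∀ {n m} (p : Subset n) (f : Fin n → Fin m) →
  (∀ {a b} → a ∈ p → b ∈ p → f a ≡ f b → a ≡ b) → ∣ p ∣ ≤ m
injectiveOn⇒∣p∣≤m {m = m} p f inj =
  subst (∣ p ∣ ≤_) (∣⊤∣≡n m) (injectiveOn⇒∣p∣≤∣q∣ p ⊤ f (λ _ → ∈⊤) inj)

injective⇒m≤∣q∣ : ∀ {m n} (q : Subset n) (f : Fin m → Fin n) →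
  (∀ i → f i ∈ q) → Injective _≡_ _≡_ f → m ≤ ∣ q ∣
injective⇒m≤∣q∣ {m} q f f∈q inj =
  subst (_≤ ∣ q ∣) (∣⊤∣≡n m) (injectiveOn⇒∣p∣≤∣q∣ ⊤ q f (λ {i} _ → f∈q i) (λ _ _ → inj))

dec-true⁻ : ∀ {A : Set} (a? : Dec A) → does a? ≡ true → A
dec-true⁻ (yes a) _ = a

splitAt-injective : ∀ m {n} → Injective _≡_ _≡_ (splitAt m {n})
splitAt-injective m {n} {a} {b} e =
  trans (sym (join-splitAt m n a)) (trans (cong (join m n) e) (join-splitAt m n b))

image : ∀ {m n} → (Fin m → Fin n) → Subset n
image f = tabulate λ a → does (any? λ i → f i ≟ a)

∈image⁺ : ∀ {m n} (f : Fin m → Fin n) i → f i ∈ image f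
∈image⁺ f i = lookup⇒[]= (f i) (image f)
  (trans (lookup∘tabulate _ (f i)) (dec-true (any? λ j → f j ≟ f i) (i , refl)))

∈image⁻ : ∀ {m n} (f : Fin m → Fin n) {a} → a ∈ image f → ∃ λ i → f i ≡ a
∈image⁻ f {a} a∈ =
  dec-true⁻ (any? λ i → f i ≟ a) (trans (sym (lookup∘tabulate _ a)) ([]=⇒lookup a∈))

image⊆ : ∀ {m n} (f : Fin m → Fin n) {p} → (∀ i → f i ∈ p) → image f ⊆ p
image⊆ f f∈p a∈ with ∈image⁻ f a∈
... | i , refl = f∈p i

∣image∣≡m : ∀ {m n} (f : Fin m → Fin n) (g : Fin n → Fin m) → (∀ i → g (f i) ≡ i) →
  ∣ image f ∣ ≡ m
∣image∣≡m f g g∘f≡id = ≤-antisym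
  (injectiveOn⇒∣p∣≤m (image f) g g-injectiveOn)
  (injective⇒m≤∣q∣ (image f) f (∈image⁺ f) f-injective)
  where
  f∘g≡id : ∀ {a} → a ∈ image f → f (g a) ≡ a
  f∘g≡id a∈ with ∈image⁻ f a∈
  ... | i , refl = cong f (g∘f≡id i)
  g-injectiveOn : ∀ {a b} → a ∈ image f → b ∈ image f → g a ≡ g b → a ≡ b
  g-injectiveOn a∈ b∈ ga≡gb = trans (sym (f∘g≡id a∈)) (trans (cong f ga≡gb) (f∘g≡id b∈))
  f-injective : Injective _≡_ _≡_ f
  f-injective {i} {j} fi≡fj = trans (sym (g∘f≡id i)) (trans (cong g fi≡fj) (g∘f≡id j))

module Reconfiguration (G : Graph) where

  dominating? : ∀ p → Dec (Dominating G p)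
  dominating? p = all? λ v → (v ∈? p) ⊎-dec any? (λ u → (u ∈? p) ×-dec (adj G u v Bool.≟ true))

  dominating-⊆ : ∀ {p q} → p ⊆ q → Dominating G p → Dominating G q
  dominating-⊆ p⊆q dom v with dom v
  ... | inj₁ v∈p = inj₁ (p⊆q v∈p)
  ... | inj₂ (u , u∈p , uv) = inj₂ (u , p⊆q u∈p , uv)

  minimal⇒irredundant : ∀ {M v} → MinimalDominating G M → v ∈ M → ¬ Dominating G (M - v)
  minimal⇒irredundant (_ , minimal) v∈M = minimal _ (x∈p⇒p-x⊂p v∈M)

  irredundant⇒minimal : ∀ {M} → Dominating G M → (∀ {v} → v ∈ M → ¬ Dominating G (M - v)) →
    MinimalDominating G M
  irredundant⇒minimal domM irredundant =
    domM , λ { T (T⊆M , v , v∈M , v∉T) domT →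
      irredundant v∈M (dominating-⊆ (λ u∈T → x∈p∧x≢y⇒x∈p-y (T⊆M u∈T) λ { refl → v∉T u∈T }) domT) }

  minimalDominatingSubset : ∀ {X} → Dominating G X → ∃ λ M → M ⊆ X × MinimalDominating G M
  minimalDominatingSubset {X} = go X (⊂-wellFounded X)
    where
    go : ∀ X → Acc _⊂_ X → Dominating G X → ∃ λ M → M ⊆ X × MinimalDominating G M
    go X (acc rec) domX with any? (λ v → (v ∈? X) ×-dec dominating? (X - v))
    ... | no irredundant =
      X , ⊆-refl , irredundant⇒minimal domX λ v∈X domX-v → irredundant (_ , v∈X , domX-v)
    ... | yes (v , v∈X , domX-v) with go (X - v) (rec (x∈p⇒p-x⊂p v∈X)) domX-v
    ... | M , M⊆X-v , minM = M , p─q⊆p X ⁅ v ⁆ ∘ M⊆X-v , minM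

  source : ∀ {j X Y} → DkPath G j X Y → DkVertex G j X
  source (here vX) = vX
  source (step vX _ _) = vX

  _++_ : ∀ {j X Y Z} → DkPath G j X Y → DkPath G j Y Z → DkPath G j X Z
  here _ ++ q = q
  step vX X~Y p ++ q = step vX X~Y (p ++ q)

  reverse : ∀ {j X Y} → DkPath G j X Y → DkPath G j Y X
  reverse (here vX) = here vX
  reverse (step vX X~Y p) = reverse p ++ step (source p) (swap X~Y) (here vX)

  descend : ∀ {j A B} → A ⊆ B → Dominating G A → ∣ B ∣ ≤ j → DkPath G j B A
  descend {j} {A} {B} = go B (⊂-wellFounded B)
    where
    go : ∀ B → Acc _⊂_ B → A ⊆ B → Dominating G A → ∣ B ∣ ≤ j → DkPath G j B A
    go B (acc rec) A⊆B domA ∣B∣≤j with any? (λ v → (v ∈? B) ×-dec ¬? (v ∈? A))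
    ... | no nothing-to-remove =
      subst (λ B → DkPath G j B A) (⊆-antisym A⊆B B⊆A)
        (here (domA , ≤-trans (p⊆q⇒∣p∣≤∣q∣ A⊆B) ∣B∣≤j))
      where
      B⊆A : B ⊆ A
      B⊆A {v} v∈B with v ∈? A
      ... | yes v∈A = v∈A
      ... | no v∉A = contradiction (v , v∈B , v∉A) nothing-to-remove
    ... | yes (v , v∈B , v∉A) =
      step (dominating-⊆ A⊆B domA , ∣B∣≤j) (inj₂ (v , x∉p-x B v , x∈p⇒p≡p-x∪⁅x⁆ v∈B))
        (go (B - v) (rec (x∈p⇒p-x⊂p v∈B)) A⊆B-v domA (≤-trans (∣p─q∣≤∣p∣ B ⁅ v ⁆) ∣B∣≤j))
      where
      A⊆B-v : A ⊆ B - v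
      A⊆B-v a∈A = x∈p∧x≢y⇒x∈p-y (A⊆B a∈A) λ { refl → v∉A a∈A }

  connected-above-Γ+γ : ∀ {k r} → IsUpperDominationNumber G k → IsDominationNumber G r →
    ∀ j → k + r ≤ j → DkConnected G j
  connected-above-Γ+γ {k} {r} (_ , Γ-bound) ((D , domD , ∣D∣≡r) , _) j k+r≤j X Y vX vY =
    toD vX ++ reverse (toD vY)
    where
    toD : ∀ {X} → DkVertex G j X → DkPath G j X D
    toD {X} (domX , ∣X∣≤j) with minimalDominatingSubset domX
    ... | M , M⊆X , minM = descend M⊆X (proj₁ minM) ∣X∣≤j
      ++ (reverse (descend (p⊆p∪q D) (proj₁ minM) ∣M∪D∣≤j)
      ++ descend (q⊆p∪q M D) domD ∣M∪D∣≤j)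
      where
      ∣M∪D∣≤j : ∣ M ∪ D ∣ ≤ j
      ∣M∪D∣≤j = ≤-trans (∣p∪q∣≤∣p∣+∣q∣ M D)
        (≤-trans (+-mono-≤ (Γ-bound M minM) (≤-reflexive ∣D∣≡r)) k+r≤j)

  isD0 : ∀ {m j} → (∀ i → m ≤ i → DkConnected G i) → m ≤ suc j → ¬ DkConnected G j → IsD0 G m
  isD0 {m} {j} connected m≤1+j disconnected = connected , least
    where
    least : ∀ m' → (∀ i → m' ≤ i → DkConnected G i) → m ≤ m'
    least m' connected' with m' ≤? j
    ... | yes m'≤j = contradiction (connected' j m'≤j) disconnected
    ... | no m'≰j = ≤-trans m≤1+j (≰⇒> m'≰j)

module FiniteGraph {V : Set} {N : ℕ} (enumeration : V ↔ Fin N)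
  {Adj : V → V → Set} (Adj? : ∀ u v → Dec (Adj u v))
  (Adj-sym : ∀ {u v} → Adj u v → Adj v u) (Adj-irrefl : ∀ {v} → ¬ Adj v v) where

  open Inverse enumeration public using (to; from)
  open Inverse enumeration using (strictlyInverseˡ; strictlyInverseʳ)

  graph : Graph
  graph = record
    { n = N
    ; adj = λ a b → does (Adj? (from a) (from b))
    ; sym = λ a b → does-⇔ (mk⇔ Adj-sym Adj-sym) (Adj? (from a) (from b)) (Adj? (from b) (from a))
    ; irrefl = λ a → dec-false (Adj? (from a) (from a)) Adj-irrefl
    }

  to-injective : Injective _≡_ _≡_ to
  to-injective {u} {v} e =
    trans (sym (strictlyInverseʳ u)) (trans (cong from e) (strictlyInverseʳ v))

  from-injective : Injective _≡_ _≡_ from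
  from-injective {a} {b} e =
    trans (sym (strictlyInverseˡ a)) (trans (cong to e) (strictlyInverseˡ b))

  _≟ᵥ_ : DecidableEquality V
  u ≟ᵥ v = map′ to-injective (cong to) (to u ≟ to v)

  infix 4 _∈ᵥ_ _∉ᵥ_

  _∈ᵥ_ : V → Subset N → Set
  u ∈ᵥ p = to u ∈ p

  _∉ᵥ_ : V → Subset N → Set
  u ∉ᵥ p = ¬ u ∈ᵥ p

  _∈ᵥ?_ : ∀ u p → Dec (u ∈ᵥ p)
  u ∈ᵥ? p = to u ∈? p

  ∈⇒from∈ᵥ : ∀ {a p} → a ∈ p → from a ∈ᵥ p
  ∈⇒from∈ᵥ {a} {p} = subst (_∈ p) (sym (strictlyInverseˡ a))

  Dominates : V → V → Set
  Dominates u v = u ≡ v ⊎ Adj u v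

  Dominates-sym : ∀ {u v} → Dominates u v → Dominates v u
  Dominates-sym (inj₁ refl) = inj₁ refl
  Dominates-sym (inj₂ uv) = inj₂ (Adj-sym uv)

  Dominatingᵥ : Subset N → Set
  Dominatingᵥ p = ∀ v → ∃ λ u → u ∈ᵥ p × Dominates u v

  dominatingᵥ : ∀ {p} → Dominating graph p → Dominatingᵥ p
  dominatingᵥ dom v with dom (to v)
  ... | inj₁ v∈p = v , v∈p , inj₁ refl
  ... | inj₂ (a , a∈p , adj≡true) = from a , ∈⇒from∈ᵥ a∈p , inj₂
    (subst (Adj (from a)) (strictlyInverseʳ v) (dec-true⁻ (Adj? (from a) (from (to v))) adj≡true))

  dominating : ∀ {p} → Dominatingᵥ p → Dominating graph p
  dominating {p} dom a with dom (from a)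
  ... | u , u∈p , inj₁ refl = inj₁ (subst (_∈ p) (strictlyInverseˡ a) u∈p)
  ... | u , u∈p , inj₂ uv = inj₂ (to u , u∈p , dec-true (Adj? (from (to u)) (from a))
    (subst (λ z → Adj z (from a)) (sym (strictlyInverseʳ u)) uv))

  Redundant : Subset N → V → Set
  Redundant M y = ∀ v → Dominates y v → ∃ λ u → u ∈ᵥ M × u ≢ y × Dominates u v

  redundant⇒dominating : ∀ {M y} → Dominatingᵥ M → Redundant M y → Dominatingᵥ (M - to y)
  redundant⇒dominating {M} {y} domM redundant v with domM v
  ... | u , u∈M , uv with u ≟ᵥ y
  ... | no u≢y = u , x∈p∧x≢y⇒x∈p-y u∈M (u≢y ∘ to-injective) , uv
  ... | yes refl with redundant v uv
  ... | u' , u'∈M , u'≢y , u'v = u' , x∈p∧x≢y⇒x∈p-y u'∈M (u'≢y ∘ to-injective) , u'v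

  ∣p∣≤m-by : ∀ {m} (p : Subset N) (c : V → Fin m) →
    (∀ {u v} → u ∈ᵥ p → v ∈ᵥ p → c u ≡ c v → u ≡ v) → ∣ p ∣ ≤ m
  ∣p∣≤m-by p c inj = injectiveOn⇒∣p∣≤m p (c ∘ from)
    λ a∈p b∈p e → from-injective (inj (∈⇒from∈ᵥ a∈p) (∈⇒from∈ᵥ b∈p) e)

  m≤∣p∣-by : ∀ {m} (p : Subset N) (f : Fin m → V) → (∀ i → f i ∈ᵥ p) → Injective _≡_ _≡_ f →
    m ≤ ∣ p ∣
  m≤∣p∣-by p f f∈p inj = injective⇒m≤∣q∣ p (to ∘ f) f∈p (inj ∘ to-injective)

  imageᵥ : ∀ {m} → (Fin m → V) → Subset N
  imageᵥ f = image (to ∘ f)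

  ∈imageᵥ⁺ : ∀ {m} (f : Fin m → V) i → f i ∈ᵥ imageᵥ f
  ∈imageᵥ⁺ f = ∈image⁺ (to ∘ f)

  ∈imageᵥ⁻ : ∀ {m} (f : Fin m → V) {u} → u ∈ᵥ imageᵥ f → ∃ λ i → f i ≡ u
  ∈imageᵥ⁻ f u∈ with ∈image⁻ (to ∘ f) u∈
  ... | i , e = i , to-injective e

  ∣imageᵥ∣≡m : ∀ {m} (f : Fin m → V) (g : V → Fin m) → (∀ i → g (f i) ≡ i) → ∣ imageᵥ f ∣ ≡ m
  ∣imageᵥ∣≡m f g g∘f≡id =
    ∣image∣≡m (to ∘ f) (g ∘ from) λ i → trans (cong g (strictlyInverseʳ (f i))) (g∘f≡id i)

-- k = k' + 1 and r = r' + 1, so that Fin k and Fin r are inhabited and k + r' = k + r − 1.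
module Construction (k' r' : ℕ) (r'<k' : r' < k') where

  k r : ℕ
  k = suc k'
  r = suc r'

  data V : Set where
    s : Fin k → V
    x : Fin k → Fin r → V
    d : Fin r → V
    w : V

  data Adj : V → V → Set where
    s-s : ∀ {i i'} → i ≢ i' → Adj (s i) (s i')
    s-x : ∀ {i j} → Adj (s i) (x i j)
    x-s : ∀ {i j} → Adj (x i j) (s i)
    x-x : ∀ {i i' j} → i ≢ i' → Adj (x i j) (x i' j)
    x-d : ∀ {i j} → Adj (x i j) (d j)
    d-x : ∀ {i j} → Adj (d j) (x i j)
    s-d : ∀ {i j} → Adj (s i) (d j)
    d-s : ∀ {i j} → Adj (d j) (s i)
    s-w : ∀ {i} → Adj (s i) w
    w-s : ∀ {i} → Adj w (s i)
    d-w : ∀ {j} → Adj (d j) w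
    w-d : ∀ {j} → Adj w (d j)

  Adj-sym : ∀ {u v} → Adj u v → Adj v u
  Adj-sym (s-s i≢i') = s-s (i≢i' ∘ sym)
  Adj-sym s-x = x-s
  Adj-sym x-s = s-x
  Adj-sym (x-x i≢i') = x-x (i≢i' ∘ sym)
  Adj-sym x-d = d-x
  Adj-sym d-x = x-d
  Adj-sym s-d = d-s
  Adj-sym d-s = s-d
  Adj-sym s-w = w-s
  Adj-sym w-s = s-w
  Adj-sym d-w = w-d
  Adj-sym w-d = d-w

  Adj-irrefl : ∀ {v} → ¬ Adj v v
  Adj-irrefl (s-s i≢i) = i≢i refl
  Adj-irrefl (x-x i≢i) = i≢i refl

  Adj? : ∀ u v → Dec (Adj u v)
  Adj? (s i) (s i') with i ≟ i'
  ... | yes refl = no λ { (s-s i≢i) → i≢i refl }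
  ... | no i≢i' = yes (s-s i≢i')
  Adj? (s i) (x i' j) with i ≟ i'
  ... | yes refl = yes s-x
  ... | no i≢i' = no λ { s-x → i≢i' refl }
  Adj? (s i) (d j) = yes s-d
  Adj? (s i) w = yes s-w
  Adj? (x i j) (s i') with i ≟ i'
  ... | yes refl = yes x-s
  ... | no i≢i' = no λ { x-s → i≢i' refl }
  Adj? (x i j) (x i' j') with j ≟ j' | i ≟ i'
  ... | no j≢j' | _ = no λ { (x-x _) → j≢j' refl }
  ... | yes refl | yes refl = no λ { (x-x i≢i) → i≢i refl }
  ... | yes refl | no i≢i' = yes (x-x i≢i')
  Adj? (x i j) (d j') with j ≟ j'
  ... | yes refl = yes x-d
  ... | no j≢j' = no λ { x-d → j≢j' refl }
  Adj? (x i j) w = no λ ()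
  Adj? (d j) (s i) = yes d-s
  Adj? (d j) (x i j') with j ≟ j'
  ... | yes refl = yes d-x
  ... | no j≢j' = no λ { d-x → j≢j' refl }
  Adj? (d j) (d j') = no λ ()
  Adj? (d j) w = yes d-w
  Adj? w (s i) = yes w-s
  Adj? w (x i j) = no λ ()
  Adj? w (d j) = yes w-d
  Adj? w w = no λ ()

  N : ℕ
  N = k + (k * r + (r + 1))

  V↔⊎ : V ↔ (Fin k ⊎ (Fin k × Fin r) ⊎ Fin r ⊎ Fin 1)
  V↔⊎ = mk↔ₛ′ toSum fromSum
    (λ { (inj₁ _) → refl ; (inj₂ (inj₁ _)) → refl
       ; (inj₂ (inj₂ (inj₁ _))) → refl ; (inj₂ (inj₂ (inj₂ zero))) → refl })
    (λ { (s i) → refl ; (x i j) → refl ; (d j) → refl ; w → refl })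
    where
    toSum : V → Fin k ⊎ (Fin k × Fin r) ⊎ Fin r ⊎ Fin 1
    toSum (s i) = inj₁ i
    toSum (x i j) = inj₂ (inj₁ (i , j))
    toSum (d j) = inj₂ (inj₂ (inj₁ j))
    toSum w = inj₂ (inj₂ (inj₂ zero))
    fromSum : Fin k ⊎ (Fin k × Fin r) ⊎ Fin r ⊎ Fin 1 → V
    fromSum (inj₁ i) = s i
    fromSum (inj₂ (inj₁ (i , j))) = x i j
    fromSum (inj₂ (inj₂ (inj₁ j))) = d j
    fromSum (inj₂ (inj₂ (inj₂ zero))) = w

  enumeration : V ↔ Fin N
  enumeration = ↔-trans V↔⊎ (↔-sym Fin↔⊎)
    where
    Fin↔⊎ : Fin N ↔ (Fin k ⊎ (Fin k × Fin r) ⊎ Fin r ⊎ Fin 1)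
    Fin↔⊎ = ↔-trans +↔⊎ (↔-refl ⊎-↔ ↔-trans +↔⊎ (*↔× ⊎-↔ ↔-trans +↔⊎ ↔-refl))

  open FiniteGraph enumeration Adj? Adj-sym Adj-irrefl public

  Q : Graph
  Q = graph

  open Reconfiguration Q using (minimal⇒irredundant; source; connected-above-Γ+γ; isD0)

  data InS∪w : V → Set where
    s : ∀ {i} → InS∪w (s i)
    w : InS∪w w

  data Hub : V → Set where
    s : ∀ {i} → Hub (s i)
    d : ∀ {j} → Hub (d j)
    w : Hub w

  data Column (j : Fin r) : V → Set where
    x : ∀ {i} → Column j (x i j)
    d : Column j (d j)

  s-dominates-s : ∀ i i' → Dominates (s i) (s i')
  s-dominates-s i i' with i ≟ i'
  ... | yes refl = inj₁ refl
  ... | no i≢i' = inj₂ (s-s i≢i')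

  Hub-dominates-S∪w : ∀ {h v} → Hub h → InS∪w v → Dominates h v
  Hub-dominates-S∪w (s {i}) (s {i'}) = s-dominates-s i i'
  Hub-dominates-S∪w s w = inj₂ s-w
  Hub-dominates-S∪w d s = inj₂ d-s
  Hub-dominates-S∪w d w = inj₂ d-w
  Hub-dominates-S∪w w s = inj₂ w-s
  Hub-dominates-S∪w w w = inj₁ refl

  column-dominates-column : ∀ {j u v} → Column j u → Column j v → Dominates u v
  column-dominates-column (x {i}) (x {i'}) with i ≟ i'
  ... | yes refl = inj₁ refl
  ... | no i≢i' = inj₂ (x-x i≢i')
  column-dominates-column x d = inj₂ x-d
  column-dominates-column d x = inj₂ d-x
  column-dominates-column d d = inj₁ refl

  Column-functional : ∀ {j j' v} → Column j v → Column j' v → j ≡ j'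
  Column-functional x x = refl
  Column-functional d d = refl

  Hub≢x : ∀ {h i j} → Hub h → h ≢ x i j
  Hub≢x s ()
  Hub≢x d ()
  Hub≢x w ()

  Column≢S∪w : ∀ {j c u} → Column j c → InS∪w u → c ≢ u
  Column≢S∪w x s ()
  Column≢S∪w x w ()
  Column≢S∪w d s ()
  Column≢S∪w d w ()

  s≢Column : ∀ {i j c} → Column j c → s i ≢ c
  s≢Column x ()
  s≢Column d ()

  S∪w-neighbourhood : ∀ {u v} → InS∪w u → Dominates u v → Hub v ⊎ ∃ λ j → Column j v
  S∪w-neighbourhood s (inj₁ refl) = inj₁ s
  S∪w-neighbourhood w (inj₁ refl) = inj₁ w
  S∪w-neighbourhood s (inj₂ (s-s _)) = inj₁ s
  S∪w-neighbourhood s (inj₂ s-x) = inj₂ (_ , x)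
  S∪w-neighbourhood s (inj₂ s-d) = inj₁ d
  S∪w-neighbourhood s (inj₂ s-w) = inj₁ w
  S∪w-neighbourhood w (inj₂ w-s) = inj₁ s
  S∪w-neighbourhood w (inj₂ w-d) = inj₁ d

  class : V → Fin (suc r)
  class (s _) = zero
  class w = zero
  class (x _ j) = suc j
  class (d j) = suc j

  same-class : ∀ u v → class u ≡ class v → InS∪w u × InS∪w v ⊎ ∃ λ j → Column j u × Column j v
  same-class (s _) (s _) _ = inj₁ (s , s)
  same-class (s _) w _ = inj₁ (s , w)
  same-class w (s _) _ = inj₁ (w , s)
  same-class w w _ = inj₁ (w , w)
  same-class (x _ _) (x _ _) e with refl ← suc-injective e = inj₂ (_ , x , x)
  same-class (x _ _) (d _) e with refl ← suc-injective e = inj₂ (_ , x , d)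
  same-class (d _) (x _ _) e with refl ← suc-injective e = inj₂ (_ , d , x)
  same-class (d _) (d _) e with refl ← suc-injective e = inj₂ (_ , d , d)

  hub-member : ∀ {T} → Dominatingᵥ T → ∃ λ h → h ∈ᵥ T × Hub h
  hub-member domT with domT w
  ... | _ , h∈T , inj₁ refl = w , h∈T , w
  ... | _ , h∈T , inj₂ s-w = _ , h∈T , s
  ... | _ , h∈T , inj₂ d-w = _ , h∈T , d

  module ColumnRepresentatives {T b} (domT : Dominatingᵥ T) (sb∉T : s b ∉ᵥ T) where

    representative : ∀ j → ∃ λ c → c ∈ᵥ T × Column j c
    representative j with domT (x b j)
    ... | _ , c∈T , inj₁ refl = x b j , c∈T , x
    ... | _ , c∈T , inj₂ s-x = contradiction c∈T sb∉T
    ... | _ , c∈T , inj₂ (x-x {i} _) = x i j , c∈T , x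
    ... | _ , c∈T , inj₂ d-x = _ , c∈T , d

    rep : Fin r → V
    rep = proj₁ ∘ representative

    rep∈T : ∀ j → rep j ∈ᵥ T
    rep∈T = proj₁ ∘ proj₂ ∘ representative

    rep-column : ∀ j → Column j (rep j)
    rep-column = proj₂ ∘ proj₂ ∘ representative

    rep-injective : Injective _≡_ _≡_ rep
    rep-injective {j} {j'} e =
      Column-functional (rep-column j) (subst (Column j') (sym e) (rep-column j'))

  r<k : r < k
  r<k = s≤s r'<k'

  S D : Subset N
  S = imageᵥ s
  D = imageᵥ d

  ∣S∣≡k : ∣ S ∣ ≡ k
  ∣S∣≡k = ∣imageᵥ∣≡m s row λ _ → refl
    where
    row : V → Fin k
    row (s i) = i
    row _ = zero

  ∣D∣≡r : ∣ D ∣ ≡ r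
  ∣D∣≡r = ∣imageᵥ∣≡m d column λ _ → refl
    where
    column : V → Fin r
    column (d j) = j
    column _ = zero

  S-dominating : Dominatingᵥ S
  S-dominating (s i) = s i , ∈imageᵥ⁺ s i , inj₁ refl
  S-dominating (x i j) = s i , ∈imageᵥ⁺ s i , inj₂ s-x
  S-dominating (d j) = s zero , ∈imageᵥ⁺ s zero , inj₂ s-d
  S-dominating w = s zero , ∈imageᵥ⁺ s zero , inj₂ s-w

  D-dominating : Dominatingᵥ D
  D-dominating (s i) = d zero , ∈imageᵥ⁺ d zero , inj₂ d-s
  D-dominating (x i j) = d j , ∈imageᵥ⁺ d j , inj₂ d-x
  D-dominating (d j) = d j , ∈imageᵥ⁺ d j , inj₁ refl
  D-dominating w = d zero , ∈imageᵥ⁺ d zero , inj₂ d-w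

  S⊆-or-missing : ∀ T → S ⊆ T ⊎ ∃ λ b → s b ∉ᵥ T
  S⊆-or-missing T with all? (λ i → s i ∈ᵥ? T)
  ... | yes S⊆T = inj₁ (image⊆ (to ∘ s) S⊆T)
  ... | no S⊈T = inj₂ (¬∀⟶∃¬ k _ (λ i → s i ∈ᵥ? T) S⊈T)

  S-minimal : MinimalDominating Q S
  S-minimal = dominating S-dominating , λ { T (T⊆S , a , a∈S , a∉T) domT →
    no-dominating-⊂S T⊆S a∈S a∉T (dominatingᵥ domT) }
    where
    no-dominating-⊂S : ∀ {T a} → T ⊆ S → a ∈ S → a ∉ T → ¬ Dominatingᵥ T
    no-dominating-⊂S T⊆S a∈S a∉T domT with ∈image⁻ (to ∘ s) a∈S
    ... | _ , refl = rep-not-s (∈imageᵥ⁻ s (T⊆S (rep∈T zero)))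
      where
      open ColumnRepresentatives domT a∉T
      rep-not-s : ¬ ∃ λ i → s i ≡ rep zero
      rep-not-s (_ , sᵢ≡rep) = s≢Column (rep-column zero) sᵢ≡rep

  module _ {M} (minM : MinimalDominating Q M) where

    private
      domM : Dominatingᵥ M
      domM = dominatingᵥ (proj₁ minM)

    irredundant : ∀ {y} → y ∈ᵥ M → ¬ Redundant M y
    irredundant y∈M redundant =
      minimal⇒irredundant minM y∈M (dominating (redundant⇒dominating domM redundant))

    x-unique-in-column : ∀ {i j c} → x i j ∈ᵥ M → c ∈ᵥ M → Column j c → c ≢ x i j → ⊥
    x-unique-in-column {i} {j} {c} x∈M c∈M c-col c≢x = irredundant x∈M redundant
      where
      redundant : Redundant M (x i j)
      redundant _ (inj₁ refl) = c , c∈M , c≢x , column-dominates-column c-col x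
      redundant _ (inj₂ (x-x _)) = c , c∈M , c≢x , column-dominates-column c-col x
      redundant _ (inj₂ x-d) = c , c∈M , c≢x , column-dominates-column c-col d
      redundant _ (inj₂ x-s) with hub-member domM
      ... | h , h∈M , hub = h , h∈M , Hub≢x hub , Hub-dominates-S∪w hub s

    column-unique : ∀ {j u v} → Column j u → Column j v → u ∈ᵥ M → v ∈ᵥ M → u ≡ v
    column-unique u-col v-col u∈M v∈M with u-col | v-col | _ ≟ᵥ _
    ... | _ | _ | yes u≡v = u≡v
    ... | x | _ | no u≢v = ⊥-elim (x-unique-in-column u∈M v∈M v-col (u≢v ∘ sym))
    ... | d | x | no u≢v = ⊥-elim (x-unique-in-column v∈M u∈M d u≢v)
    ... | d | d | no u≢v = ⊥-elim (u≢v refl)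

    S∪w-unique : ∀ {b u v} → s b ∉ᵥ M → InS∪w u → InS∪w v → u ∈ᵥ M → v ∈ᵥ M → u ≡ v
    S∪w-unique {b} {u} {v} sb∉M u-S∪w v-S∪w u∈M v∈M with u ≟ᵥ v
    ... | yes u≡v = u≡v
    ... | no u≢v = ⊥-elim (irredundant u∈M redundant)
      where
      redundant : Redundant M u
      redundant _ uy with S∪w-neighbourhood u-S∪w uy
      ... | inj₁ hub = v , v∈M , u≢v ∘ sym , Dominates-sym (Hub-dominates-S∪w hub v-S∪w)
      ... | inj₂ (j , y-col) =
        rep j , rep∈T j , Column≢S∪w (rep-column j) u-S∪w ,
        column-dominates-column (rep-column j) y-col
        where open ColumnRepresentatives domM sb∉M

    Γ-bound : ∣ M ∣ ≤ k
    Γ-bound with S⊆-or-missing M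
    ... | inj₁ S⊆M = subst (∣ M ∣ ≤_) ∣S∣≡k (p⊆q⇒∣p∣≤∣q∣ M⊆S)
      where
      M⊆S : M ⊆ S
      M⊆S {a} a∈M with a ∈? S
      ... | yes a∈S = a∈S
      ... | no a∉S = contradiction (dominating S-dominating) (proj₂ minM S (S⊆M , a , a∈M , a∉S))
    ... | inj₂ (b , sb∉M) = ≤-trans (∣p∣≤m-by M class one-per-class) r<k
      where
      one-per-class : ∀ {u v} → u ∈ᵥ M → v ∈ᵥ M → class u ≡ class v → u ≡ v
      one-per-class {u} {v} u∈M v∈M e with same-class u v e
      ... | inj₁ (u-S∪w , v-S∪w) = S∪w-unique sb∉M u-S∪w v-S∪w u∈M v∈M
      ... | inj₂ (_ , u-col , v-col) = column-unique u-col v-col u∈M v∈M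

  γ-bound : ∀ T → Dominating Q T → r ≤ ∣ T ∣
  γ-bound T domT with S⊆-or-missing T
  ... | inj₁ S⊆T = ≤-trans (<⇒≤ r<k) (subst (_≤ ∣ T ∣) ∣S∣≡k (p⊆q⇒∣p∣≤∣q∣ S⊆T))
  ... | inj₂ (b , sb∉T) = m≤∣p∣-by T rep rep∈T rep-injective
    where open ColumnRepresentatives (dominatingᵥ domT) sb∉T

  k+r≤∣X∣ : ∀ {X T b} → S ⊆ X → T ⊆ X → Dominatingᵥ T → s b ∉ᵥ T → k + r ≤ ∣ X ∣
  k+r≤∣X∣ {X} S⊆X T⊆X domT sb∉T =
    m≤∣p∣-by X (f ∘ splitAt k) (f∈X ∘ splitAt k) (splitAt-injective k ∘ f-injective)
    where
    open ColumnRepresentatives domT sb∉T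
    f : Fin k ⊎ Fin r → V
    f = [ s , rep ]
    f∈X : ∀ t → f t ∈ᵥ X
    f∈X (inj₁ i) = S⊆X (∈imageᵥ⁺ s i)
    f∈X (inj₂ j) = T⊆X (rep∈T j)
    f-injective : Injective _≡_ _≡_ f
    f-injective {inj₁ i} {inj₁ i'} refl = refl
    f-injective {inj₁ i} {inj₂ j} e = ⊥-elim (s≢Column (rep-column j) e)
    f-injective {inj₂ j} {inj₁ i} e = ⊥-elim (s≢Column (rep-column j) (sym e))
    f-injective {inj₂ j} {inj₂ j'} e = cong inj₂ (rep-injective e)

  S⊆-along-path : ∀ {j X Y} → j < k + r → DkPath Q j X Y → S ⊆ X → S ⊆ Y
  S⊆-along-path j<k+r (here _) S⊆X = S⊆X
  S⊆-along-path j<k+r (step _ (inj₁ (v , _ , refl)) p) S⊆X =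
    S⊆-along-path j<k+r p (p⊆p∪q ⁅ v ⁆ ∘ S⊆X)
  S⊆-along-path {j} j<k+r (step {T = T} (_ , ∣X∣≤j) (inj₂ (v , v∉T , refl)) p) S⊆X =
    S⊆-along-path j<k+r p S⊆T
    where
    S⊆T : S ⊆ T
    S⊆T {a} a∈S with x∈p∪q⁻ T ⁅ v ⁆ (S⊆X a∈S) | ∈image⁻ (to ∘ s) a∈S
    ... | inj₁ a∈T | _ = a∈T
    ... | inj₂ a∈⁅v⁆ | _ , refl with refl ← x∈⁅y⁆⇒x≡y v a∈⁅v⁆ =
      contradiction (≤-trans (k+r≤∣X∣ S⊆X (p⊆p∪q ⁅ v ⁆) domT v∉T) ∣X∣≤j) (<⇒≱ j<k+r)
      where
      domT : Dominatingᵥ T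
      domT = dominatingᵥ (proj₁ (source p))

  disconnected : ∀ {j} → k ≤ j → j < k + r → ¬ DkConnected Q j
  disconnected {j} k≤j j<k+r connected =
    s∉D (S⊆-along-path j<k+r (connected S D vS vD) ⊆-refl (∈imageᵥ⁺ s zero))
    where
    vS : DkVertex Q j S
    vS = dominating S-dominating , subst (_≤ j) (sym ∣S∣≡k) k≤j
    vD : DkVertex Q j D
    vD = dominating D-dominating , subst (_≤ j) (sym ∣D∣≡r) (≤-trans (<⇒≤ r<k) k≤j)
    s∉D : s zero ∉ᵥ D
    s∉D s∈D with ∈imageᵥ⁻ d {s zero} s∈D
    ... | _ , ()

  Γ : IsUpperDominationNumber Q k
  Γ = (S , S-minimal , ∣S∣≡k) , λ _ → Γ-bound

  γ : IsDominationNumber Q r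
  γ = (D , dominating D-dominating , ∣D∣≡r) , γ-bound

  d₀ : IsD0 Q (k + r)
  d₀ = isD0 (connected-above-Γ+γ Γ γ) (≤-reflexive (+-suc k r'))
    (disconnected (m≤m+n k r') (≤-reflexive (sym (+-suc k r'))))

theorem2 : ∀ (k r : ℕ) → 3 ≤ k → 1 ≤ r → r < k →
    Σ Graph λ Q →
    IsUpperDominationNumber Q k × IsDominationNumber Q r × IsD0 Q (k + r)
-- The construction only needs 1 ≤ r < k.
theorem2 (suc k') (suc r') _ _ (s≤s r'<k') = Q , Γ , γ , d₀
  where open Construction k' r' r'<k'
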